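{- For every integer $n \ge 2$ there exists a $3$-uniform hypergraph $H$ with $N = n^2$ vertices and average degree $d = \frac{3(n-1)^2}{4}$ such that $H$ contains no copy of $K_4^{ -(3)}$ (and hence no copy of $K_4^{(3)}$), and whose independence number satisfies $\alpha(H) < 2n < 2\frac{N}{d^{1/2}}$.
   Context: A $3$-uniform hypergraph is a pair $(V,E)$ with $E \subseteq \binom{V}{3}$. The degree of a vertex is the number of edges containing it; the average degree is the average of the degrees over all vertices. An independent set is a set of vertices containing no edge, and $\alpha(H)$ is the maximum size of an independent set. $K_4^{(3)}$ is the complete $3$-uniform hypergraph on $4$ vertices (all $4$ triples), and $K_4^{ -(3)}$ is the $3$-uniform hypergraph on $4$ vertices with $3$ edges. "$H$ contains a copy of $F$" means $H$ has a subhypergraph isomorphic to $F$. -}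

module Defs where

open import Data.Nat using (ℕ; _+_; _*_)
open import Data.Fin using (Fin)
open import Data.Fin.Subset using (Subset; ⁅_⁆; _∪_; _⊆_; ∣_∣) renaming (_∈_ to _∈ₛ_)
open import Data.Fin.Subset.Properties using (_∈?_)
open import Data.List using (List; length; filter; map; allFin)
open import Data.Nat.ListAction using (sum)
open import Data.List.Membership.Propositional using (_∈_)
open import Data.List.Relation.Unary.All using (All)
open import Data.List.Relation.Unary.Unique.Propositional using (Unique)
open import Data.Product using (_×_; ∃-syntax)
open import Relation.Binary.PropositionalEquality using (_≡_; _≢_)
open import Relation.Nullary using (¬_)

record Hypergraph3 (N : ℕ) : Set where
  field
    edges    : List (Subset N)
    uniform  : All (λ e → ∣ e ∣ ≡ 3) edges
    distinct : Unique edges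
open Hypergraph3 public

triple : ∀ {N} → Fin N → Fin N → Fin N → Subset N
triple a b c = ⁅ a ⁆ ∪ ⁅ b ⁆ ∪ ⁅ c ⁆

degree : ∀ {N} → Hypergraph3 N → Fin N → ℕ
degree H v = length (filter (v ∈?_) (edges H))

-- sum of all degrees (average degree = degreeSum H / N)
degreeSum : ∀ {N} → Hypergraph3 N → ℕ
degreeSum {N} H = sum (map (degree H) (allFin N))

Distinct4 : ∀ {N} → Fin N → Fin N → Fin N → Fin N → Set
Distinct4 a b c d = a ≢ b × a ≢ c × a ≢ d × b ≢ c × b ≢ d × c ≢ d

-- H contains a copy of K4^{-(3)}: four distinct vertices spanning
-- (at least) three of the four triples (w.l.o.g. all triples through a)
ContainsK4⁻ : ∀ {N} → Hypergraph3 N → Set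
ContainsK4⁻ {N} H = ∃[ a ] ∃[ b ] ∃[ c ] ∃[ d ]
  (Distinct4 {N} a b c d × triple a b c ∈ edges H × triple a b d ∈ edges H × triple a c d ∈ edges H)

ContainsK4 : ∀ {N} → Hypergraph3 N → Set
ContainsK4 {N} H = ∃[ a ] ∃[ b ] ∃[ c ] ∃[ d ]
  (Distinct4 {N} a b c d × triple a b c ∈ edges H × triple a b d ∈ edges H
     × triple a c d ∈ edges H × triple b c d ∈ edges H)

Independent : ∀ {N} → Hypergraph3 N → Subset N → Set
Independent H S = All (λ e → ¬ (e ⊆ S)) (edges H)

module Submission where

-- Vertices are the cells of the n × n grid; for rows i < i' and columns j < j' there is one
-- edge, the L-shape {(i',j'), (i,j'), (i',j)}: a corner, the cell above it and the cell to
-- its left.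

open import Defs
open import Data.Nat using (ℕ; zero; suc; _+_; _*_; _∸_; _^_; _≤_; _<_; z≤n; z<s; s<s)
open import Data.Nat.Properties
  using (≤-refl; ≤-reflexive; ≤-trans; +-mono-≤; +-monoʳ-<; m≤m+n; m≤n+m; +-suc;
         +-assoc; +-identityʳ; *-suc; *-zeroʳ; *-identityʳ; *-comm; *-mono-≤; *-distribˡ-+; *-monoʳ-≤; *-monoʳ-<; *-monoˡ-<;
         n<1+n; n≤1+n; <⇒≤; module ≤-Reasoning; +-0-commutativeMonoid)
open import Algebra.Properties.CommutativeMonoid.Sum +-0-commutativeMonoid
  using (sum; sum-syntax; sum-cong-≗; sum-replicate-zero; ∑-distrib-+; ∑-comm)
open import Data.Nat.Tactic.RingSolver using (solve-∀)
import Data.Nat.ListAction as ListAction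
open import Data.Bool using (if_then_else_)
open import Data.Fin using (Fin; zero; suc; _↑ˡ_; _↑ʳ_; combine; remQuot)
  renaming (_<_ to _<ᶠ_; _≤_ to _≤ᶠ_)
open import Data.Fin.Properties
  using (suc-injective; <-cmp; _<?_; <-irrefl; ≤-antisym; any?; combine-injective;
         remQuot-combine)
  renaming (≤-refl to ≤ᶠ-refl)
open import Data.Fin.Subset using (Subset; inside; outside; ⁅_⁆; _∪_; _⊆_; ∣_∣)
  renaming (_∈_ to _∈ₛ_; _∉_ to _∉ₛ_)
open import Data.Fin.Subset.Properties using (_∈?_; x∈⁅x⁆; x∈⁅y⁆⇒x≡y; x∈p∪q⁻; x∈p∪q⁺; ∣⁅x⁆∣≡1)
open import Data.Vec using ([]; _∷_; here; there)
open import Data.List using (List; []; _∷_; length; filter; map; allFin; tabulate; _++_; cartesianProduct)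
open import Data.List.Properties using (length-++; length-map; length-tabulate; map-tabulate)
open import Data.List.Membership.Propositional using (_∈_)
open import Data.List.Membership.Propositional.Properties
  using (∈-map⁺; ∈-map⁻; ∈-++⁺ˡ; ∈-++⁺ʳ; ∈-++⁻; ∈-allFin; ∈-cartesianProduct⁺; ∈-cartesianProduct⁻)
open import Data.List.Relation.Unary.All as All using (All; []; _∷_)
import Data.List.Relation.Unary.All.Properties as All
open import Data.List.Relation.Unary.AllPairs using ([]; _∷_)
open import Data.List.Relation.Unary.Unique.Propositional using (Unique)
import Data.List.Relation.Unary.Unique.Propositional.Properties as Unique
open import Data.Sum using (_⊎_; inj₁; inj₂)
open import Data.Product as Product using (_×_; _,_; proj₁; proj₂; ∃-syntax)
open import Data.Empty using (⊥; ⊥-elim)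
open import Function using (_∘_; id)
open import Relation.Binary.Definitions using (tri<; tri≈; tri>)
open import Relation.Binary.PropositionalEquality
  using (_≡_; _≢_; refl; sym; trans; cong; cong₂; subst; subst₂; module ≡-Reasoning)
open import Relation.Nullary using (¬_; Dec; yes; no; does; _×-dec_; ¬?)

∑-mono-≤ : ∀ {n} {f g : Fin n → ℕ} → (∀ i → f i ≤ g i) → sum f ≤ sum g
∑-mono-≤ {zero}  f≤g = z≤n
∑-mono-≤ {suc n} f≤g = +-mono-≤ (f≤g zero) (∑-mono-≤ (f≤g ∘ suc))

∑-≤-count : ∀ {n} {f : Fin n → ℕ} → (∀ i → f i ≤ 1) → sum f ≤ n
∑-≤-count {zero}  f≤1 = z≤n
∑-≤-count {suc n} f≤1 = +-mono-≤ (f≤1 zero) (∑-≤-count (f≤1 ∘ suc))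

∑-↑ : ∀ m {n} (f : Fin (m + n) → ℕ) → sum f ≡ sum (f ∘ (_↑ˡ n)) + sum (f ∘ (m ↑ʳ_))
∑-↑ zero    f = refl
∑-↑ (suc m) f = trans (cong (f zero +_) (∑-↑ m (f ∘ suc))) (sym (+-assoc (f zero) _ _))

∑-combine : ∀ m {n} (f : Fin (m * n) → ℕ) → sum f ≡ ∑[ i < m ] ∑[ j < n ] f (combine i j)
∑-combine zero        f = refl
∑-combine (suc m) {n} f =
  trans (∑-↑ n f) (cong (sum (λ j → f (j ↑ˡ (m * n))) +_) (∑-combine m (f ∘ (n ↑ʳ_))))

listSum-allFin : ∀ {n} (f : Fin n → ℕ) → ListAction.sum (map f (allFin n)) ≡ sum f
listSum-allFin {n} f = trans (cong ListAction.sum (map-tabulate id f)) (tabulated f)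
  where
  tabulated : ∀ {k} (g : Fin k → ℕ) → ListAction.sum (tabulate g) ≡ sum g
  tabulated {zero}  g = refl
  tabulated {suc k} g = cong (g zero +_) (tabulated (g ∘ suc))

𝟙 : ∀ {P : Set} → Dec P → ℕ
𝟙 P? = if does P? then 1 else 0

𝟙-yes : ∀ {P : Set} (P? : Dec P) → P → 𝟙 P? ≡ 1
𝟙-yes (yes _) _ = refl
𝟙-yes (no ¬p) p = ⊥-elim (¬p p)

𝟙-no : ∀ {P : Set} (P? : Dec P) → ¬ P → 𝟙 P? ≡ 0
𝟙-no (yes p) ¬p = ⊥-elim (¬p p)
𝟙-no (no _)  _  = refl

𝟙-cover : ∀ {P Q S : Set} (P? : Dec P) (Q? : Dec Q) (S? : Dec S) →
          (P → Q ⊎ S) → 𝟙 P? ≤ 𝟙 Q? + 𝟙 S?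
𝟙-cover (no _)  Q? S? cover = z≤n
𝟙-cover (yes p) Q? S? cover with cover p
... | inj₁ q = ≤-trans (≤-reflexive (sym (𝟙-yes Q? q))) (m≤m+n (𝟙 Q?) (𝟙 S?))
... | inj₂ s = ≤-trans (≤-reflexive (sym (𝟙-yes S? s))) (m≤n+m (𝟙 S?) (𝟙 Q?))

∑𝟙-empty : ∀ {n} {P : Fin n → Set} (P? : ∀ i → Dec (P i)) → (∀ i → ¬ P i) → ∑[ i < n ] 𝟙 (P? i) ≡ 0
∑𝟙-empty {n} P? ¬P = trans (sum-cong-≗ (λ i → 𝟙-no (P? i) (¬P i))) (sum-replicate-zero n)

∑𝟙-unique : ∀ {n} {P : Fin n → Set} (P? : ∀ i → Dec (P i)) →
            (∀ {i j} → P i → P j → i ≡ j) → ∑[ i < n ] 𝟙 (P? i) ≤ 1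
∑𝟙-unique {zero}  P? unique = z≤n
∑𝟙-unique {suc n} P? unique with P? zero
... | yes p₀ = ≤-reflexive (cong suc (∑𝟙-empty (P? ∘ suc) (λ i pᵢ → zero≢suc (unique p₀ pᵢ))))
  where
  zero≢suc : ∀ {i : Fin n} → Fin.zero ≢ suc i
  zero≢suc ()
... | no _   = ∑𝟙-unique (P? ∘ suc) (λ pᵢ pⱼ → suc-injective (unique pᵢ pⱼ))

∣p∣≡∑𝟙 : ∀ {n} (p : Subset n) → ∣ p ∣ ≡ ∑[ x < n ] 𝟙 (x ∈? p)
∣p∣≡∑𝟙 []            = refl
∣p∣≡∑𝟙 (inside  ∷ p) = cong suc (∣p∣≡∑𝟙 p)
∣p∣≡∑𝟙 (outside ∷ p) = ∣p∣≡∑𝟙 p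

∣∪∣-disjoint : ∀ {n} (p q : Subset n) → (∀ {x} → x ∈ₛ p → x ∉ₛ q) → ∣ p ∪ q ∣ ≡ ∣ p ∣ + ∣ q ∣
∣∪∣-disjoint []            []            disj = refl
∣∪∣-disjoint (outside ∷ p) (outside ∷ q) disj = ∣∪∣-disjoint p q (λ x∈p x∈q → disj (there x∈p) (there x∈q))
∣∪∣-disjoint (outside ∷ p) (inside  ∷ q) disj =
  trans (cong suc (∣∪∣-disjoint p q (λ x∈p x∈q → disj (there x∈p) (there x∈q)))) (sym (+-suc ∣ p ∣ ∣ q ∣))
∣∪∣-disjoint (inside  ∷ p) (outside ∷ q) disj = cong suc (∣∪∣-disjoint p q (λ x∈p x∈q → disj (there x∈p) (there x∈q)))
∣∪∣-disjoint (inside  ∷ p) (inside  ∷ q) disj = ⊥-elim (disj here here)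

∈-triple⁻ : ∀ {N} {x a b c : Fin N} → x ∈ₛ triple a b c → x ≡ a ⊎ x ≡ b ⊎ x ≡ c
∈-triple⁻ {a = a} {b} {c} x∈ with x∈p∪q⁻ ⁅ a ⁆ _ x∈
... | inj₁ x∈a = inj₁ (x∈⁅y⁆⇒x≡y a x∈a)
... | inj₂ x∈bc with x∈p∪q⁻ ⁅ b ⁆ ⁅ c ⁆ x∈bc
...   | inj₁ x∈b = inj₂ (inj₁ (x∈⁅y⁆⇒x≡y b x∈b))
...   | inj₂ x∈c = inj₂ (inj₂ (x∈⁅y⁆⇒x≡y c x∈c))

∈-triple⁺ : ∀ {N} {x a b c : Fin N} → x ≡ a ⊎ x ≡ b ⊎ x ≡ c → x ∈ₛ triple a b c
∈-triple⁺ {a = a}     (inj₁ refl)        = x∈p∪q⁺ (inj₁ (x∈⁅x⁆ a))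
∈-triple⁺ {b = b}     (inj₂ (inj₁ refl)) = x∈p∪q⁺ (inj₂ (x∈p∪q⁺ (inj₁ (x∈⁅x⁆ b))))
∈-triple⁺ {c = c}     (inj₂ (inj₂ refl)) = x∈p∪q⁺ (inj₂ (x∈p∪q⁺ (inj₂ (x∈⁅x⁆ c))))

∣triple∣≡3 : ∀ {N} {a b c : Fin N} → a ≢ b → a ≢ c → b ≢ c → ∣ triple a b c ∣ ≡ 3
∣triple∣≡3 {a = a} {b} {c} a≢b a≢c b≢c = begin
  ∣ ⁅ a ⁆ ∪ ⁅ b ⁆ ∪ ⁅ c ⁆ ∣             ≡⟨ ∣∪∣-disjoint ⁅ a ⁆ _ a∉bc ⟩
  ∣ ⁅ a ⁆ ∣ + ∣ ⁅ b ⁆ ∪ ⁅ c ⁆ ∣         ≡⟨ cong (∣ ⁅ a ⁆ ∣ +_) (∣∪∣-disjoint ⁅ b ⁆ ⁅ c ⁆ b∉c) ⟩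
  ∣ ⁅ a ⁆ ∣ + (∣ ⁅ b ⁆ ∣ + ∣ ⁅ c ⁆ ∣)   ≡⟨ cong₂ _+_ (∣⁅x⁆∣≡1 a) (cong₂ _+_ (∣⁅x⁆∣≡1 b) (∣⁅x⁆∣≡1 c)) ⟩
  3                                     ∎
  where
  open ≡-Reasoning
  a∉bc : ∀ {x} → x ∈ₛ ⁅ a ⁆ → x ∉ₛ ⁅ b ⁆ ∪ ⁅ c ⁆
  a∉bc x∈a x∈bc with x∈⁅y⁆⇒x≡y a x∈a | x∈p∪q⁻ ⁅ b ⁆ ⁅ c ⁆ x∈bc
  ... | refl | inj₁ x∈b = a≢b (x∈⁅y⁆⇒x≡y b x∈b)
  ... | refl | inj₂ x∈c = a≢c (x∈⁅y⁆⇒x≡y c x∈c)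
  b∉c : ∀ {x} → x ∈ₛ ⁅ b ⁆ → x ∉ₛ ⁅ c ⁆
  b∉c x∈b x∈c with x∈⁅y⁆⇒x≡y b x∈b
  ... | refl = b≢c (x∈⁅y⁆⇒x≡y c x∈c)

length-filter-∷ : ∀ {A : Set} {P : A → Set} (P? : ∀ x → Dec (P x)) x xs →
                  length (filter P? (x ∷ xs)) ≡ 𝟙 (P? x) + length (filter P? xs)
length-filter-∷ P? x xs with P? x
... | yes _ = refl
... | no  _ = refl

∑-incidences : ∀ {N} (E : List (Subset N)) →
               ∑[ v < N ] length (filter (v ∈?_) E) ≡ ListAction.sum (map ∣_∣ E)
∑-incidences {N} []      = sum-replicate-zero N
∑-incidences {N} (e ∷ E) = begin
  ∑[ v < N ] length (filter (v ∈?_) (e ∷ E))                     ≡⟨ sum-cong-≗ (λ v → length-filter-∷ (v ∈?_) e E) ⟩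
  ∑[ v < N ] (𝟙 (v ∈? e) + length (filter (v ∈?_) E))            ≡⟨ ∑-distrib-+ (λ v → 𝟙 (v ∈? e)) _ ⟩
  ∑[ v < N ] 𝟙 (v ∈? e) + ∑[ v < N ] length (filter (v ∈?_) E)   ≡⟨ cong₂ _+_ (sym (∣p∣≡∑𝟙 e)) (∑-incidences E) ⟩
  ∣ e ∣ + ListAction.sum (map ∣_∣ E)                              ∎
  where open ≡-Reasoning

listSum-constant : ∀ {A : Set} {f : A → ℕ} {k} {xs : List A} →
                   All (λ x → f x ≡ k) xs → ListAction.sum (map f xs) ≡ k * length xs
listSum-constant {k = k} []                   = sym (*-zeroʳ k)
listSum-constant {k = k} {x ∷ xs} (refl ∷ fxs) =
  trans (cong (k +_) (listSum-constant fxs)) (sym (*-suc k (length xs)))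

Unique-map⁺ : ∀ {A B : Set} {P : A → Set} (f : A → B) → (∀ {x y} → P x → P y → f x ≡ f y → x ≡ y) →
              ∀ {xs} → All P xs → Unique xs → Unique (map f xs)
Unique-map⁺ f injective []         []             = []
Unique-map⁺ {P = P} f injective (px ∷ pxs) (x∉xs ∷ uniq) = images-differ pxs x∉xs ∷ Unique-map⁺ f injective pxs uniq
  where
  images-differ : ∀ {ys} → All P ys → All (_ ≢_) ys → All (f _ ≢_) (map f ys)
  images-differ []         []           = []
  images-differ (py ∷ pys) (x≢y ∷ x≢ys) = (x≢y ∘ injective px py) ∷ images-differ pys x≢ys

length-cartesianProduct : ∀ {A B : Set} (xs : List A) (ys : List B) →
                          length (cartesianProduct xs ys) ≡ length xs * length ys
length-cartesianProduct []       ys = refl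
length-cartesianProduct (x ∷ xs) ys =
  trans (length-++ (map (x ,_) ys)) (cong₂ _+_ (length-map (x ,_) ys) (length-cartesianProduct xs ys))

orderedPairs : ∀ n → List (Fin n × Fin n)
orderedPairs zero    = []
orderedPairs (suc n) = map (λ j → zero , suc j) (allFin n) ++ map (Product.map suc suc) (orderedPairs n)

orderedPairs-sound : ∀ {n i j} → (i , j) ∈ orderedPairs n → i <ᶠ j
orderedPairs-sound {suc n} ij∈ with ∈-++⁻ (map (λ j → zero , suc j) (allFin n)) ij∈
... | inj₁ ∈first with ∈-map⁻ (λ j → zero , suc j) ∈first
...   | _ , _ , refl = z<s
orderedPairs-sound {suc n} ij∈ | inj₂ ∈shifted with ∈-map⁻ (Product.map suc suc) ∈shifted
...   | _ , ∈pairs , refl = s<s (orderedPairs-sound ∈pairs)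

orderedPairs-complete : ∀ {n i j} → i <ᶠ j → (i , j) ∈ orderedPairs n
orderedPairs-complete {suc n} {zero}  {suc j} _ = ∈-++⁺ˡ (∈-map⁺ (λ j → zero , suc j) (∈-allFin j))
orderedPairs-complete {suc n} {suc i} {suc j} (s<s i<j) =
  ∈-++⁺ʳ (map (λ j → zero , suc j) (allFin n)) (∈-map⁺ (Product.map suc suc) (orderedPairs-complete i<j))

orderedPairs-unique : ∀ n → Unique (orderedPairs n)
orderedPairs-unique zero    = []
orderedPairs-unique (suc n) =
  Unique.++⁺ (Unique.map⁺ first-injective (Unique.allFin⁺ n))
             (Unique.map⁺ shift-injective (orderedPairs-unique n))
             first-disjoint-shifted
  where
  first-injective : ∀ {j k : Fin n} → (Fin.zero {n} , suc j) ≡ (zero , suc k) → j ≡ k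
  first-injective refl = refl
  shift-injective : ∀ {p q : Fin n × Fin n} → Product.map suc suc p ≡ Product.map suc suc q → p ≡ q
  shift-injective {_ , _} {_ , _} refl = refl
  first-disjoint-shifted : ∀ {p} → p ∈ map (λ j → zero , suc j) (allFin n) ×
                                   p ∈ map (Product.map suc suc) (orderedPairs n) → ⊥
  first-disjoint-shifted (∈first , ∈shifted)
    with ∈-map⁻ (λ j → zero , suc j) ∈first | ∈-map⁻ (Product.map suc suc) ∈shifted
  ... | _ , _ , refl | _ , _ , ()

orderedPairs-length : ∀ k → 2 * length (orderedPairs (suc k)) ≡ suc k * k
orderedPairs-length zero    = refl
orderedPairs-length (suc k) = begin
  2 * length (orderedPairs (suc (suc k)))   ≡⟨ cong (2 *_) length-step ⟩
  2 * (suc k + L)                           ≡⟨ *-distribˡ-+ 2 (suc k) L ⟩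
  2 * suc k + 2 * L                         ≡⟨ cong (2 * suc k +_) (orderedPairs-length k) ⟩
  2 * suc k + suc k * k                     ≡⟨ regroup k ⟩
  suc (suc k) * suc k                       ∎
  where
  open ≡-Reasoning
  L : ℕ
  L = length (orderedPairs (suc k))
  length-step : length (orderedPairs (suc (suc k))) ≡ suc k + L
  length-step = trans (length-++ (map (λ j → zero , suc j) (allFin (suc k))))
    (cong₂ _+_ (trans (length-map _ (allFin (suc k))) (length-tabulate id)) (length-map _ (orderedPairs (suc k))))
  regroup : ∀ k → 2 * suc k + suc k * k ≡ suc (suc k) * suc k
  regroup = solve-∀

module Grid (n : ℕ) where

  cell : Fin n → Fin n → Fin (n * n)
  cell = combine

  row col : Fin (n * n) → Fin n
  row v = proj₁ (remQuot {n} n v)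
  col v = proj₂ (remQuot {n} n v)

  row-cell : ∀ i j → row (cell i j) ≡ i
  row-cell i j = cong proj₁ (remQuot-combine {n} {n} i j)

  col-cell : ∀ i j → col (cell i j) ≡ j
  col-cell i j = cong proj₂ (remQuot-combine {n} {n} i j)

  cell-injective : ∀ {a b c d} → cell a b ≡ cell c d → a ≡ c × b ≡ d
  cell-injective {a} {b} {c} {d} = combine-injective a b c d

  -- A rectangle ((i , i') , (j , j')) spans rows i..i' and columns j..j'; it is proper if
  -- i < i' and j < j'.
  Rect : Set
  Rect = (Fin n × Fin n) × (Fin n × Fin n)

  Proper : Rect → Set
  Proper ((i , i') , (j , j')) = i <ᶠ i' × j <ᶠ j'

  rects : List Rect
  rects = cartesianProduct (orderedPairs n) (orderedPairs n)

  rects-proper : ∀ {r} → r ∈ rects → Proper r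
  rects-proper r∈ with ∈-cartesianProduct⁻ (orderedPairs n) (orderedPairs n) r∈
  ... | rows∈ , cols∈ = orderedPairs-sound rows∈ , orderedPairs-sound cols∈

  rects-complete : ∀ {i i' j j'} → i <ᶠ i' → j <ᶠ j' → ((i , i') , (j , j')) ∈ rects
  rects-complete i<i' j<j' = ∈-cartesianProduct⁺ (orderedPairs-complete i<i') (orderedPairs-complete j<j')

  data Role : Set where
    corner top left : Role

  vertex : Rect → Role → Fin (n * n)
  vertex ((i , i') , (j , j')) corner = cell i' j'
  vertex ((i , i') , (j , j')) top    = cell i  j'
  vertex ((i , i') , (j , j')) left   = cell i' j

  lShape : Rect → Subset (n * n)
  lShape r = triple (vertex r corner) (vertex r top) (vertex r left)

  vertex∈lShape : ∀ r ρ → vertex r ρ ∈ₛ lShape r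
  vertex∈lShape r corner = ∈-triple⁺ (inj₁ refl)
  vertex∈lShape r top    = ∈-triple⁺ (inj₂ (inj₁ refl))
  vertex∈lShape r left   = ∈-triple⁺ (inj₂ (inj₂ refl))

  role : ∀ {r x} → x ∈ₛ lShape r → ∃[ ρ ] x ≡ vertex r ρ
  role x∈ with ∈-triple⁻ x∈
  ... | inj₁ x≡corner        = corner , x≡corner
  ... | inj₂ (inj₁ x≡top)    = top , x≡top
  ... | inj₂ (inj₂ x≡left)   = left , x≡left

  role-in : ∀ {r x a b c} → triple a b c ≡ lShape r → x ≡ a ⊎ x ≡ b ⊎ x ≡ c → ∃[ ρ ] x ≡ vertex r ρ
  role-in abc≡r x∈abc = role (subst (_ ∈ₛ_) abc≡r (∈-triple⁺ x∈abc))

  ∣lShape∣≡3 : ∀ {r} → Proper r → ∣ lShape r ∣ ≡ 3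
  ∣lShape∣≡3 {(i , i') , (j , j')} (i<i' , j<j') = ∣triple∣≡3
    (λ eq → <-irrefl (sym (proj₁ (cell-injective eq))) i<i')
    (λ eq → <-irrefl (sym (proj₂ (cell-injective eq))) j<j')
    (λ eq → <-irrefl (proj₁ (cell-injective eq)) i<i')

  -- The L-shape of a proper rectangle spans it as its bounding box.
  InBox : Rect → Fin n → Fin n → Set
  InBox ((i , i') , (j , j')) a b = (i ≤ᶠ a × a ≤ᶠ i') × (j ≤ᶠ b × b ≤ᶠ j')

  inBox : ∀ {r a b} → Proper r → cell a b ∈ₛ lShape r → InBox r a b
  inBox {(i , i') , (j , j')} {a} {b} (i<i' , j<j') ab∈ with role ab∈
  ... | corner , eq with cell-injective eq
  ...   | refl , refl = (<⇒≤ i<i' , ≤ᶠ-refl) , (<⇒≤ j<j' , ≤ᶠ-refl)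
  inBox (i<i' , j<j') ab∈ | top , eq with cell-injective eq
  ...   | refl , refl = (≤ᶠ-refl , <⇒≤ i<i') , (<⇒≤ j<j' , ≤ᶠ-refl)
  inBox (i<i' , j<j') ab∈ | left , eq with cell-injective eq
  ...   | refl , refl = (<⇒≤ i<i' , ≤ᶠ-refl) , (≤ᶠ-refl , <⇒≤ j<j')

  lShape-injective : ∀ {r s} → Proper r → Proper s → lShape r ≡ lShape s → r ≡ s
  lShape-injective {r@((i , i') , (j , j'))} {s@((k , k') , (l , l'))} proper-r proper-s eq =
    cong₂ _,_ (cong₂ _,_ (≤-antisym (proj₁ (proj₁ (in-r top-s)))    (proj₁ (proj₁ (in-s top-r))))
                         (≤-antisym (proj₂ (proj₁ (in-s corner-r))) (proj₂ (proj₁ (in-r corner-s)))))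
              (cong₂ _,_ (≤-antisym (proj₁ (proj₂ (in-r left-s)))   (proj₁ (proj₂ (in-s left-r))))
                         (≤-antisym (proj₂ (proj₂ (in-s corner-r))) (proj₂ (proj₂ (in-r corner-s)))))
    where
    in-r : ∀ {a b} → cell a b ∈ₛ lShape s → InBox r a b
    in-r ab∈ = inBox proper-r (subst (_ ∈ₛ_) (sym eq) ab∈)
    in-s : ∀ {a b} → cell a b ∈ₛ lShape r → InBox s a b
    in-s ab∈ = inBox proper-s (subst (_ ∈ₛ_) eq ab∈)
    corner-r : cell i' j' ∈ₛ lShape r
    corner-r = vertex∈lShape r corner
    top-r : cell i j' ∈ₛ lShape r
    top-r = vertex∈lShape r top
    left-r : cell i' j ∈ₛ lShape r
    left-r = vertex∈lShape r left
    corner-s : cell k' l' ∈ₛ lShape s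
    corner-s = vertex∈lShape s corner
    top-s : cell k l' ∈ₛ lShape s
    top-s = vertex∈lShape s top
    left-s : cell k' l ∈ₛ lShape s
    left-s = vertex∈lShape s left

  edgeList : List (Subset (n * n))
  edgeList = map lShape rects

  H : Hypergraph3 (n * n)
  H = record
    { edges    = edgeList
    ; uniform  = All.map⁺ (All.tabulate (∣lShape∣≡3 ∘ rects-proper))
    ; distinct = Unique-map⁺ lShape lShape-injective (All.tabulate rects-proper)
                   (Unique.cartesianProduct⁺ (orderedPairs-unique n) (orderedPairs-unique n))
    }

  degreeSum-H : degreeSum H ≡ 3 * (length (orderedPairs n) * length (orderedPairs n))
  degreeSum-H = begin
    degreeSum H                             ≡⟨ listSum-allFin (degree H) ⟩
    ∑[ v < n * n ] degree H v               ≡⟨ ∑-incidences edgeList ⟩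
    ListAction.sum (map ∣_∣ edgeList)       ≡⟨ listSum-constant (uniform H) ⟩
    3 * length edgeList                     ≡⟨ cong (3 *_) (length-map lShape rects) ⟩
    3 * length rects                        ≡⟨ cong (3 *_) (length-cartesianProduct (orderedPairs n) (orderedPairs n)) ⟩
    3 * (length (orderedPairs n) * length (orderedPairs n)) ∎
    where open ≡-Reasoning

data Side : Set where
  before level after : Side

side : ∀ {n} → Fin n → Fin n → Side
side x y with <-cmp y x
... | tri< _ _ _ = before
... | tri≈ _ _ _ = level
... | tri> _ _ _ = after

side-before : ∀ {n} {x y : Fin n} → y <ᶠ x → side x y ≡ before
side-before {x = x} {y} y<x with <-cmp y x
... | tri< _ _ _   = refl
... | tri≈ y≮x _ _ = ⊥-elim (y≮x y<x)
... | tri> y≮x _ _ = ⊥-elim (y≮x y<x)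

side-level : ∀ {n} (x : Fin n) → side x x ≡ level
side-level x with <-cmp x x
... | tri< x<x _ _ = ⊥-elim (<-irrefl refl x<x)
... | tri≈ _ _ _   = refl
... | tri> _ _ x<x = ⊥-elim (<-irrefl refl x<x)

side-after : ∀ {n} {x y : Fin n} → x <ᶠ y → side x y ≡ after
side-after {x = x} {y} x<y with <-cmp y x
... | tri< _ _ x≮y = ⊥-elim (x≮y x<y)
... | tri≈ _ _ x≮y = ⊥-elim (x≮y x<y)
... | tri> _ _ _   = refl

Dir : Set
Dir = Side × Side

-- The six pairs of directions in which one vertex of an L-shape sees the other two:
-- the corner sees them above and to the left, the top vertex below and below-left,
-- the left vertex to the right and above-right (each pair in both orders).
data Partners : Dir → Dir → Set where
  atCorner  : Partners (before , level) (level , before)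
  atCorner′ : Partners (level , before) (before , level)
  atTop     : Partners (after , level) (after , before)
  atTop′    : Partners (after , before) (after , level)
  atLeft    : Partners (level , after) (before , after)
  atLeft′   : Partners (before , after) (level , after)

-- Partnership is a perfect matching, so it contains no triangle.
Partners-no-triangle : ∀ {d e f} → Partners d e → Partners d f → Partners e f → ⊥
Partners-no-triangle atCorner  atCorner  ()
Partners-no-triangle atCorner′ atCorner′ ()
Partners-no-triangle atTop     atTop     ()
Partners-no-triangle atTop′    atTop′    ()
Partners-no-triangle atLeft    atLeft    ()
Partners-no-triangle atLeft′   atLeft′   ()

module K₄⁻-Free (n : ℕ) where
  open Grid n

  dir : Fin (n * n) → Fin (n * n) → Dir
  dir u v = side (row u) (row v) , side (col u) (col v)

  dir-cell : ∀ a b c d → dir (cell a b) (cell c d) ≡ (side a c , side b d)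
  dir-cell a b c d = cong₂ _,_ (cong₂ side (row-cell a b) (row-cell c d)) (cong₂ side (col-cell a b) (col-cell c d))

  module Views {i i' j j' : Fin n} (i<i' : i <ᶠ i') (j<j' : j <ᶠ j') where
    sees : ∀ {a b c d s t} → side a c ≡ s → side b d ≡ t → dir (cell a b) (cell c d) ≡ (s , t)
    sees {a} {b} {c} {d} vertical horizontal = trans (dir-cell a b c d) (cong₂ _,_ vertical horizontal)

    corner→top  : dir (cell i' j') (cell i j') ≡ (before , level)
    corner→top  = sees (side-before i<i') (side-level j')
    corner→left : dir (cell i' j') (cell i' j) ≡ (level , before)
    corner→left = sees (side-level i') (side-before j<j')
    top→corner  : dir (cell i j') (cell i' j') ≡ (after , level)
    top→corner  = sees (side-after i<i') (side-level j')
    top→left    : dir (cell i j') (cell i' j) ≡ (after , before)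
    top→left    = sees (side-after i<i') (side-before j<j')
    left→corner : dir (cell i' j) (cell i' j') ≡ (level , after)
    left→corner = sees (side-level i') (side-after j<j')
    left→top    : dir (cell i' j) (cell i j') ≡ (before , after)
    left→top    = sees (side-before i<i') (side-after j<j')

  partners : ∀ {r} → Proper r → ∀ ρ σ τ → ρ ≢ σ → ρ ≢ τ → σ ≢ τ →
             Partners (dir (vertex r ρ) (vertex r σ)) (dir (vertex r ρ) (vertex r τ))
  partners _ corner corner _ ρ≢σ _ _ = ⊥-elim (ρ≢σ refl)
  partners _ top    top    _ ρ≢σ _ _ = ⊥-elim (ρ≢σ refl)
  partners _ left   left   _ ρ≢σ _ _ = ⊥-elim (ρ≢σ refl)
  partners _ corner _ corner _ ρ≢τ _ = ⊥-elim (ρ≢τ refl)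
  partners _ top    _ top    _ ρ≢τ _ = ⊥-elim (ρ≢τ refl)
  partners _ left   _ left   _ ρ≢τ _ = ⊥-elim (ρ≢τ refl)
  partners _ _ corner corner _ _ σ≢τ = ⊥-elim (σ≢τ refl)
  partners _ _ top    top    _ _ σ≢τ = ⊥-elim (σ≢τ refl)
  partners _ _ left   left   _ _ σ≢τ = ⊥-elim (σ≢τ refl)
  partners (i<i' , j<j') corner top left _ _ _ = subst₂ Partners (sym corner→top) (sym corner→left) atCorner
    where open Views i<i' j<j'
  partners (i<i' , j<j') corner left top _ _ _ = subst₂ Partners (sym corner→left) (sym corner→top) atCorner′
    where open Views i<i' j<j'
  partners (i<i' , j<j') top corner left _ _ _ = subst₂ Partners (sym top→corner) (sym top→left) atTop
    where open Views i<i' j<j'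
  partners (i<i' , j<j') top left corner _ _ _ = subst₂ Partners (sym top→left) (sym top→corner) atTop′
    where open Views i<i' j<j'
  partners (i<i' , j<j') left corner top _ _ _ = subst₂ Partners (sym left→corner) (sym left→top) atLeft
    where open Views i<i' j<j'
  partners (i<i' , j<j') left top corner _ _ _ = subst₂ Partners (sym left→top) (sym left→corner) atLeft′
    where open Views i<i' j<j'

  edge-partners : ∀ {a b c} → a ≢ b → a ≢ c → b ≢ c → triple a b c ∈ edges H →
                  Partners (dir a b) (dir a c)
  edge-partners {a} {b} {c} a≢b a≢c b≢c abc∈ with ∈-map⁻ lShape abc∈
  ... | r , r∈ , abc≡r with role-in abc≡r (inj₁ refl) | role-in abc≡r (inj₂ (inj₁ refl))
                          | role-in abc≡r (inj₂ (inj₂ refl))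
  ... | ρ , refl | σ , refl | τ , refl =
    partners (rects-proper r∈) ρ σ τ (a≢b ∘ cong (vertex r)) (a≢c ∘ cong (vertex r)) (b≢c ∘ cong (vertex r))

  -- In a K₄⁻ the three edges through a would make dir a b, dir a c, dir a d a triangle.
  no-K₄⁻ : ¬ ContainsK4⁻ H
  no-K₄⁻ (a , b , c , d , (a≢b , a≢c , a≢d , b≢c , b≢d , c≢d) , abc∈ , abd∈ , acd∈) =
    Partners-no-triangle (edge-partners a≢b a≢c b≢c abc∈) (edge-partners a≢b a≢d b≢d abd∈)
                         (edge-partners a≢c a≢d c≢d acd∈)

  no-K₄ : ¬ ContainsK4 H
  no-K₄ (a , b , c , d , distinct₄ , abc∈ , abd∈ , acd∈ , _) = no-K₄⁻ (a , b , c , d , distinct₄ , abc∈ , abd∈ , acd∈)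

module LFreeGrid {m n : ℕ} (R : Fin (suc m) → Fin n → Set) (R? : ∀ i j → Dec (R i j)) where

  LFree : Set
  LFree = ∀ {i i' j j'} → i <ᶠ i' → j <ᶠ j' → R i' j' → R i j' → R i' j → ⊥

  Above Leftward : Fin (suc m) → Fin n → Set
  Above    i j = ∃[ k ] (k <ᶠ i × R k j)
  Leftward i j = ∃[ l ] (l <ᶠ j × R i l)

  Top RowHead : Fin (suc m) → Fin n → Set
  Top     i j = R i j × ¬ Above i j
  RowHead i j = R i j × Above i j × ¬ Leftward i j

  Above? : ∀ i j → Dec (Above i j)
  Above? i j = any? (λ k → (k <? i) ×-dec R? k j)

  Leftward? : ∀ i j → Dec (Leftward i j)
  Leftward? i j = any? (λ l → (l <? j) ×-dec R? i l)

  Top? : ∀ i j → Dec (Top i j)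
  Top? i j = R? i j ×-dec ¬? (Above? i j)

  RowHead? : ∀ i j → Dec (RowHead i j)
  RowHead? i j = R? i j ×-dec (Above? i j ×-dec ¬? (Leftward? i j))

  top-or-head : LFree → ∀ {i j} → R i j → Top i j ⊎ RowHead i j
  top-or-head lfree {i} {j} r
    with Above? i j | Leftward? i j
  ... | no ¬above                  | _                         = inj₁ (r , ¬above)
  ... | yes above                  | no ¬leftward              = inj₂ (r , above , ¬leftward)
  ... | yes (k , k<i , above-cell) | yes (l , l<j , left-cell) = ⊥-elim (lfree k<i l<j r above-cell left-cell)

  top-unique : ∀ {i i' j} → Top i j → Top i' j → i ≡ i'
  top-unique {i} {i'} (r , ¬above) (r' , ¬above') with <-cmp i i'
  ... | tri< i<i' _ _ = ⊥-elim (¬above' (i , i<i' , r))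
  ... | tri≈ _ i≡i' _ = i≡i'
  ... | tri> _ _ i'<i = ⊥-elim (¬above (i' , i'<i , r'))

  head-unique : ∀ {i j j'} → RowHead i j → RowHead i j' → j ≡ j'
  head-unique {i} {j} {j'} (r , _ , ¬left) (r' , _ , ¬left') with <-cmp j j'
  ... | tri< j<j' _ _ = ⊥-elim (¬left' (j , j<j' , r))
  ... | tri≈ _ j≡j' _ = j≡j'
  ... | tri> _ _ j'<j = ⊥-elim (¬left (j' , j'<j , r'))

  no-head-in-first-row : ∀ j → ¬ RowHead zero j
  no-head-in-first-row j (_ , (_ , () , _) , _)

  -- An L-free set has at most n + m cells: n column tops and m row heads.
  L-free-bound : LFree → ∑[ i < suc m ] ∑[ j < n ] 𝟙 (R? i j) ≤ n + m
  L-free-bound lfree = begin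
    ∑[ i < suc m ] ∑[ j < n ] 𝟙 (R? i j)
      ≤⟨ ∑-mono-≤ (λ i → ∑-mono-≤ (λ j → 𝟙-cover (R? i j) (Top? i j) (RowHead? i j) (top-or-head lfree))) ⟩
    ∑[ i < suc m ] ∑[ j < n ] (𝟙 (Top? i j) + 𝟙 (RowHead? i j))
      ≡⟨ sum-cong-≗ (λ i → ∑-distrib-+ (λ j → 𝟙 (Top? i j)) (λ j → 𝟙 (RowHead? i j))) ⟩
    ∑[ i < suc m ] (∑[ j < n ] 𝟙 (Top? i j) + ∑[ j < n ] 𝟙 (RowHead? i j))
      ≡⟨ ∑-distrib-+ (λ i → ∑[ j < n ] 𝟙 (Top? i j)) (λ i → ∑[ j < n ] 𝟙 (RowHead? i j)) ⟩
    ∑[ i < suc m ] ∑[ j < n ] 𝟙 (Top? i j) + ∑[ i < suc m ] ∑[ j < n ] 𝟙 (RowHead? i j)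
      ≤⟨ +-mono-≤ tops heads ⟩
    n + m ∎
    where
    open ≤-Reasoning
    tops : ∑[ i < suc m ] ∑[ j < n ] 𝟙 (Top? i j) ≤ n
    tops = ≤-trans (≤-reflexive (∑-comm (λ i j → 𝟙 (Top? i j))))
                   (∑-≤-count (λ j → ∑𝟙-unique (λ i → Top? i j) top-unique))
    heads : ∑[ i < suc m ] ∑[ j < n ] 𝟙 (RowHead? i j) ≤ m
    heads = +-mono-≤ (≤-reflexive (∑𝟙-empty (RowHead? zero) no-head-in-first-row))
                     (∑-≤-count (λ i → ∑𝟙-unique (RowHead? (suc i)) head-unique))

module Independence (m : ℕ) where
  open Grid (suc m)

  independent-L-free : ∀ {S} → Independent H S → LFreeGrid.LFree (λ i j → cell i j ∈ₛ S) (λ i j → cell i j ∈? S)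
  independent-L-free {S} independent {i} {i'} {j} {j'} i<i' j<j' corner∈ top∈ left∈ =
    All.lookup independent (∈-map⁺ lShape (rects-complete i<i' j<j')) lShape⊆S
    where
    lShape⊆S : lShape ((i , i') , (j , j')) ⊆ S
    lShape⊆S x∈ with ∈-triple⁻ x∈
    ... | inj₁ refl        = corner∈
    ... | inj₂ (inj₁ refl) = top∈
    ... | inj₂ (inj₂ refl) = left∈

  independent-bound : ∀ S → Independent H S → ∣ S ∣ < 2 * suc m
  independent-bound S independent = begin-strict
    ∣ S ∣                                                  ≡⟨ ∣p∣≡∑𝟙 S ⟩
    ∑[ v < suc m * suc m ] 𝟙 (v ∈? S)                      ≡⟨ ∑-combine (suc m) (λ v → 𝟙 (v ∈? S)) ⟩
    ∑[ i < suc m ] ∑[ j < suc m ] 𝟙 (cell i j ∈? S)        ≤⟨ LFreeGrid.L-free-bound _ (λ i j → cell i j ∈? S) (independent-L-free independent) ⟩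
    suc m + m                                              <⟨ +-monoʳ-< (suc m) (n<1+n m) ⟩
    suc m + suc m                                          ≡⟨ cong (suc m +_) (sym (+-identityʳ (suc m))) ⟩
    2 * suc m                                              ∎
    where open ≤-Reasoning

-- If 2L = n·m then 4 · 3L² = 3m²n², i.e. 4 Σ deg = 3 (n - 1)² N when |E| = L².
four-times-3L² : ∀ m L → 2 * L ≡ suc m * m → 4 * (3 * (L * L)) ≡ 3 * m ^ 2 * (suc m * suc m)
four-times-3L² m L 2L≡nm = begin
  4 * (3 * (L * L))                 ≡⟨ double-inside L ⟩
  3 * ((2 * L) * (2 * L))           ≡⟨ cong (λ x → 3 * (x * x)) 2L≡nm ⟩
  3 * ((suc m * m) * (suc m * m))   ≡⟨ regroup m ⟩
  3 * m ^ 2 * (suc m * suc m)       ∎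
  where
  open ≡-Reasoning
  double-inside : ∀ L → 4 * (3 * (L * L)) ≡ 3 * ((2 * L) * (2 * L))
  double-inside = solve-∀
  regroup : ∀ m → 3 * ((suc m * m) * (suc m * m)) ≡ 3 * (m * (m * 1)) * (suc m * suc m)
  regroup = solve-∀

-- d < N, multiplied through by 4N: this is 2n < 2N/√d.
degree-below-N : ∀ m → suc m * suc m * (3 * m ^ 2) < 4 * (suc m * suc m) * (suc m * suc m)
degree-below-N m = begin-strict
  N * (3 * m ^ 2)   ≤⟨ *-monoʳ-≤ N (*-monoʳ-≤ 3 m²≤N) ⟩
  N * (3 * N)       <⟨ *-monoʳ-< N (*-monoˡ-< N (n<1+n 3)) ⟩
  N * (4 * N)       ≡⟨ *-comm N (4 * N) ⟩
  4 * N * N         ∎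
  where
  open ≤-Reasoning
  N : ℕ
  N = suc m * suc m
  m²≤N : m ^ 2 ≤ N
  m²≤N = *-mono-≤ (n≤1+n m) (≤-trans (≤-reflexive (*-identityʳ m)) (n≤1+n m))

mainTheorem1 : (n : ℕ) → 2 ≤ n →
    ∃[ H ] (4 * degreeSum {n * n} H ≡ 3 * (n ∸ 1) ^ 2 * (n * n)
      × ¬ ContainsK4⁻ H
      × ¬ ContainsK4 H
      × ((S : Subset (n * n)) → Independent H S → ∣ S ∣ < 2 * n)
      × n * n * (3 * (n ∸ 1) ^ 2) < 4 * (n * n) * (n * n))
mainTheorem1 zero    ()
mainTheorem1 (suc m) _ =
  H , four-times-degreeSum , K₄⁻-Free.no-K₄⁻ (suc m) , K₄⁻-Free.no-K₄ (suc m) ,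
  Independence.independent-bound m , degree-below-N m
  where
  open Grid (suc m)
  four-times-degreeSum : 4 * degreeSum H ≡ 3 * m ^ 2 * (suc m * suc m)
  four-times-degreeSum =
    trans (cong (4 *_) degreeSum-H) (four-times-3L² m (length (orderedPairs (suc m))) (orderedPairs-length m))
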